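{- Let $\ell, m, r$ be positive integers such that $2\nmid \ell$, $3\nmid \ell m$, $\ell>r$ and $3\mid r$. Then every solution $(x,y,z)$ in positive integers of the equation $(r\ell m^2-1)^x+((\ell-r)\ell m^2+1)^y=(\ell m)^z$ satisfies $2\nmid xy$. -}

module Defs where

{-# OPTIONS --safe #-}
-- Write a = rℓm² - 1, b = (ℓ - r)ℓm² + 1 and c = ℓm, so that a + b = c².
-- Modulo ℓ we have a ≡ -1, b ≡ 1 and c ≡ 0: an even x would give 2 ≡ 0, impossible as ℓ > r ≥ 3.
-- Modulo 3 we have a ≡ -1 and, since c² ≡ 1, also b ≡ -1: an odd x and an even y would give
-- c^z ≡ 0, contradicting 3 ∤ c.
module Submission where

open import Defs
open import Data.Nat using (ℕ; zero; suc; _+_; _*_; _∸_; _^_; _<_; _≤_; NonZero; >-nonZero; s≤s)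
open import Data.Nat.Properties
open import Data.Nat.DivMod
open import Data.Nat.Divisibility
open import Data.Nat.Primality using (Prime; euclidsLemma; prime[2]; prime?; prime⇒nonZero)
open import Data.Nat.Solver using (module +-*-Solver)
open import Data.Sum using (inj₁; inj₂; [_,_]′)
open import Data.Empty using (⊥)
open import Relation.Nullary using (¬_; contradiction; yes; no)
open import Relation.Nullary.Decidable using (from-yes)
open import Relation.Binary.PropositionalEquality

infix 4 _≡_[mod_]

_≡_[mod_] : ℕ → ℕ → (d : ℕ) → .{{NonZero d}} → Set
a ≡ b [mod d ] = a % d ≡ b % d

module _ {d : ℕ} .{{_ : NonZero d}} where

  +-cong-mod : ∀ {a b c e} → a ≡ b [mod d ] → c ≡ e [mod d ] → a + c ≡ b + e [mod d ]
  +-cong-mod {a} {b} {c} {e} a≡b c≡e = begin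
    (a + c) % d             ≡⟨ %-distribˡ-+ a c d ⟩
    (a % d + c % d) % d     ≡⟨ cong₂ (λ u v → (u + v) % d) a≡b c≡e ⟩
    (b % d + e % d) % d     ≡⟨ %-distribˡ-+ b e d ⟨
    (b + e) % d             ∎
    where open ≡-Reasoning

  *-cong-mod : ∀ {a b c e} → a ≡ b [mod d ] → c ≡ e [mod d ] → a * c ≡ b * e [mod d ]
  *-cong-mod {a} {b} {c} {e} a≡b c≡e = begin
    (a * c) % d             ≡⟨ %-distribˡ-* a c d ⟩
    (a % d * (c % d)) % d   ≡⟨ cong₂ (λ u v → (u * v) % d) a≡b c≡e ⟩
    (b % d * (e % d)) % d   ≡⟨ %-distribˡ-* b e d ⟨
    (b * e) % d             ∎
    where open ≡-Reasoning

  ^-cong-mod : ∀ {a b} n → a ≡ b [mod d ] → a ^ n ≡ b ^ n [mod d ]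
  ^-cong-mod zero    a≡b = refl
  ^-cong-mod (suc n) a≡b = *-cong-mod a≡b (^-cong-mod n a≡b)

  -- d ∣ suc a expresses a ≡ -1 (mod d).

  ∣suc⇒*≡1 : ∀ {a} → d ∣ suc a → a * a ≡ 1 [mod d ]
  ∣suc⇒*≡1 {a} d∣1+a = begin
    (a * a) % d             ≡⟨ %-remove-+ʳ (a * a) d∣1+a ⟨
    (a * a + suc a) % d     ≡⟨ cong (_% d) (identity a) ⟩
    (suc a * a + 1) % d     ≡⟨ %-remove-+ˡ 1 (∣-trans d∣1+a (m∣m*n a)) ⟩
    1 % d                   ∎
    where
    open ≡-Reasoning
    open +-*-Solver
    identity : ∀ a → a * a + (1 + a) ≡ (1 + a) * a + 1
    identity = solve 1 (λ a → a :* a :+ (con 1 :+ a) := (con 1 :+ a) :* a :+ con 1) refl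

  ∣suc⇒^-suc-suc : ∀ {a} n → d ∣ suc a → a ^ suc (suc n) ≡ a ^ n [mod d ]
  ∣suc⇒^-suc-suc {a} n d∣1+a = begin
    (a * (a * a ^ n)) % d   ≡⟨ cong (_% d) (*-assoc a a (a ^ n)) ⟨
    (a * a * a ^ n) % d     ≡⟨ *-cong-mod (∣suc⇒*≡1 d∣1+a) (refl {x = (a ^ n) % d}) ⟩
    (1 * a ^ n) % d         ≡⟨ cong (_% d) (*-identityˡ (a ^ n)) ⟩
    (a ^ n) % d             ∎
    where open ≡-Reasoning

  ∣suc⇒^-even≡1 : ∀ {a} n → d ∣ suc a → 2 ∣ n → a ^ n ≡ 1 [mod d ]
  ∣suc⇒^-even≡1 zero          d∣1+a 2∣n = refl
  ∣suc⇒^-even≡1 (suc zero)    d∣1+a 2∣1 = contradiction (∣1⇒≡1 2∣1) λ ()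
  ∣suc⇒^-even≡1 (suc (suc n)) d∣1+a 2∣2+n =
    trans (∣suc⇒^-suc-suc n d∣1+a) (∣suc⇒^-even≡1 n d∣1+a (∣m+n∣m⇒∣n 2∣2+n ∣-refl))

  ∣suc⇒^-odd≡id : ∀ {a} n → d ∣ suc a → ¬ 2 ∣ n → a ^ n ≡ a [mod d ]
  ∣suc⇒^-odd≡id zero          d∣1+a 2∤0   = contradiction (2 ∣0) 2∤0
  ∣suc⇒^-odd≡id {a} (suc zero) d∣1+a 2∤1  = cong (_% d) (*-identityʳ a)
  ∣suc⇒^-odd≡id (suc (suc n)) d∣1+a 2∤2+n =
    trans (∣suc⇒^-suc-suc n d∣1+a) (∣suc⇒^-odd≡id n d∣1+a (λ 2∣n → 2∤2+n (∣m∣n⇒∣m+n ∣-refl 2∣n)))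

prime∣^⇒∣ : ∀ {p} c n → Prime p → p ∣ c ^ n → p ∣ c
prime∣^⇒∣ c zero    p-prime p∣1 with ∣1⇒≡1 p∣1
prime∣^⇒∣ c zero    () p∣1 | refl
prime∣^⇒∣ c (suc n) p-prime p∣c*cⁿ with euclidsLemma c (c ^ n) p-prime p∣c*cⁿ
... | inj₁ p∣c  = p∣c
... | inj₂ p∣cⁿ = prime∣^⇒∣ c n p-prime p∣cⁿ

¬3∣n⇒3∣n²+2 : ∀ n → ¬ 3 ∣ n → 3 ∣ n ^ 2 + 2
¬3∣n⇒3∣n²+2 n 3∤n = m%n≡0⇒n∣m (n ^ 2 + 2) 3 (trans reduce (by-residue (n % 3) refl (m%n<n n 3)))
  where
  reduce : n ^ 2 + 2 ≡ (n % 3) ^ 2 + 2 [mod 3 ]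
  reduce = +-cong-mod {a = n ^ 2} {b = (n % 3) ^ 2} {c = 2} {e = 2}
             (^-cong-mod {a = n} {b = n % 3} 2 (sym (m%n%n≡m%n n 3))) refl
  by-residue : ∀ k → n % 3 ≡ k → k < 3 → (k ^ 2 + 2) % 3 ≡ 0
  by-residue 0 n%3≡0 _ = contradiction (m%n≡0⇒n∣m n 3 n%3≡0) 3∤n
  by-residue 1 _ _ = refl
  by-residue 2 _ _ = refl
  by-residue (suc (suc (suc _))) _ (s≤s (s≤s (s≤s ())))

^-even+^≢^ : ∀ {d a b c} .{{_ : NonZero d}} → 2 < d → d ∣ suc a → b ≡ 1 [mod d ] → d ∣ c →
             ∀ x y z → 0 < z → 2 ∣ x → a ^ x + b ^ y ≢ c ^ z
^-even+^≢^ {d} {a} {b} {c} 2<d d∣1+a b≡1 d∣c x y (suc z) _ 2∣x eq = contradiction 2≡0 λ ()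
  where
  open ≡-Reasoning
  bʸ≡1 : b ^ y ≡ 1 [mod d ]
  bʸ≡1 = trans (^-cong-mod y b≡1) (cong (_% d) (^-zeroˡ y))
  2≡0 : 2 ≡ 0
  2≡0 = begin
    2                       ≡⟨ m<n⇒m%n≡m 2<d ⟨
    (1 + 1) % d             ≡⟨ +-cong-mod (∣suc⇒^-even≡1 x d∣1+a 2∣x) bʸ≡1 ⟨
    (a ^ x + b ^ y) % d     ≡⟨ cong (_% d) eq ⟩
    (c * c ^ z) % d         ≡⟨ n∣m⇒m%n≡0 (c * c ^ z) d (∣-trans d∣c (m∣m*n (c ^ z))) ⟩
    0                       ∎

^-odd+^-even≢^ : ∀ {p a b c} → Prime p → p ∣ suc a → p ∣ suc b → ¬ p ∣ c →
                 ∀ x y z → ¬ 2 ∣ x → 2 ∣ y → a ^ x + b ^ y ≢ c ^ z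
^-odd+^-even≢^ {p} {a} {b} {c} p-prime p∣1+a p∣1+b p∤c x y z 2∤x 2∣y eq =
  p∤c (prime∣^⇒∣ c z p-prime (m%n≡0⇒n∣m (c ^ z) p cᶻ≡0))
  where
  instance
    p≢0 : NonZero p
    p≢0 = prime⇒nonZero p-prime
  open ≡-Reasoning
  cᶻ≡0 : (c ^ z) % p ≡ 0
  cᶻ≡0 = begin
    (c ^ z) % p             ≡⟨ cong (_% p) eq ⟨
    (a ^ x + b ^ y) % p     ≡⟨ +-cong-mod {p} (∣suc⇒^-odd≡id x p∣1+a 2∤x) (∣suc⇒^-even≡1 y p∣1+b 2∣y) ⟩
    (a + 1) % p             ≡⟨ n∣m⇒m%n≡0 (a + 1) p (subst (p ∣_) (+-comm 1 a) p∣1+a) ⟩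
    0                       ∎

base-sum≡square : ∀ ℓ m r → r ≤ ℓ → .{{NonZero (r * ℓ * m ^ 2)}} →
                  (r * ℓ * m ^ 2 ∸ 1) + ((ℓ ∸ r) * ℓ * m ^ 2 + 1) ≡ (ℓ * m) ^ 2
base-sum≡square ℓ m r r≤ℓ = begin
  (K ∸ 1) + (T + 1)                ≡⟨ cong ((K ∸ 1) +_) (+-comm T 1) ⟩
  (K ∸ 1) + suc T                  ≡⟨ +-suc (K ∸ 1) T ⟩
  suc (K ∸ 1) + T                  ≡⟨ cong (_+ T) (suc-pred K) ⟩
  r * ℓ * m ^ 2 + (ℓ ∸ r) * ℓ * m ^ 2 ≡⟨ distrib r (ℓ ∸ r) ℓ m ⟩
  (r + (ℓ ∸ r)) * ℓ * m ^ 2        ≡⟨ cong (λ s → s * ℓ * m ^ 2) (m+[n∸m]≡n r≤ℓ) ⟩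
  ℓ * ℓ * m ^ 2                    ≡⟨ square ℓ m ⟩
  (ℓ * m) ^ 2                      ∎
  where
  open ≡-Reasoning
  open +-*-Solver
  K = r * ℓ * m ^ 2
  T = (ℓ ∸ r) * ℓ * m ^ 2
  distrib : ∀ p q u v → p * u * v ^ 2 + q * u * v ^ 2 ≡ (p + q) * u * v ^ 2
  distrib = solve 4 (λ p q u v → p :* u :* v :^ 2 :+ q :* u :* v :^ 2 := (p :+ q) :* u :* v :^ 2) refl
  square : ∀ u v → u * u * v ^ 2 ≡ (u * v) ^ 2
  square = solve 2 (λ u v → u :* u :* v :^ 2 := (u :* v) :^ 2) refl

lemma3p1 : (ℓ m r : ℕ) → 0 < ℓ → 0 < m → 0 < r →
           ¬ (2 ∣ ℓ) → ¬ (3 ∣ ℓ * m) → r < ℓ → 3 ∣ r →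
           (x y z : ℕ) → 0 < x → 0 < y → 0 < z →
           (r * ℓ * m ^ 2 ∸ 1) ^ x + ((ℓ ∸ r) * ℓ * m ^ 2 + 1) ^ y ≡ (ℓ * m) ^ z →
           ¬ (2 ∣ x * y)
lemma3p1 ℓ m r 0<ℓ 0<m 0<r _ 3∤ℓm r<ℓ 3∣r x y z _ _ 0<z eq 2∣xy =
  [ x-even , y-even ]′ (euclidsLemma x y prime[2] 2∣xy)
  where
  instance
    ℓ≢0 = >-nonZero 0<ℓ
    m≢0 = >-nonZero 0<m
    r≢0 = >-nonZero 0<r
    K≢0 = m*n≢0 (r * ℓ) (m ^ 2) {{m*n≢0 r ℓ}} {{m^n≢0 m 2}}
  K = r * ℓ * m ^ 2
  a = K ∸ 1
  b = (ℓ ∸ r) * ℓ * m ^ 2 + 1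
  2<ℓ : 2 < ℓ
  2<ℓ = <-trans (∣⇒≤ 3∣r) r<ℓ
  ∣K⇒∣1+a : ∀ {d} → d ∣ K → d ∣ suc a
  ∣K⇒∣1+a {d} = subst (d ∣_) (sym (suc-pred K))
  x-even : 2 ∣ x → ⊥
  x-even 2∣x = ^-even+^≢^ 2<ℓ ℓ∣1+a b≡1 (m∣m*n m) x y z 0<z 2∣x eq
    where
    ℓ∣1+a : ℓ ∣ suc a
    ℓ∣1+a = ∣K⇒∣1+a (∣-trans (n∣m*n r) (m∣m*n (m ^ 2)))
    b≡1 : b ≡ 1 [mod ℓ ]
    b≡1 = %-remove-+ˡ 1 (∣-trans (n∣m*n (ℓ ∸ r)) (m∣m*n (m ^ 2)))
  y-even : 2 ∣ y → ⊥
  y-even 2∣y with 2 ∣? x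
  ... | yes 2∣x = x-even 2∣x
  ... | no 2∤x  = ^-odd+^-even≢^ prime[3] 3∣1+a 3∣1+b 3∤ℓm x y z 2∤x 2∣y eq
    where
    prime[3] : Prime 3
    prime[3] = from-yes (prime? 3)
    3∣1+a : 3 ∣ suc a
    3∣1+a = ∣K⇒∣1+a (∣-trans 3∣r (∣-trans (m∣m*n ℓ) (m∣m*n (m ^ 2))))
    1+a+1+b≡c²+2 : suc a + suc b ≡ (ℓ * m) ^ 2 + 2
    1+a+1+b≡c²+2 = begin
      suc a + suc b         ≡⟨ +-suc (suc a) b ⟩
      2 + (a + b)           ≡⟨ +-comm 2 (a + b) ⟩
      a + b + 2             ≡⟨ cong (_+ 2) (base-sum≡square ℓ m r (<⇒≤ r<ℓ)) ⟩
      (ℓ * m) ^ 2 + 2       ∎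
      where open ≡-Reasoning
    3∣1+b : 3 ∣ suc b
    3∣1+b = ∣m+n∣m⇒∣n (subst (3 ∣_) (sym 1+a+1+b≡c²+2) (¬3∣n⇒3∣n²+2 (ℓ * m) 3∤ℓm)) 3∣1+a
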